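{- Let $W$ be a recurrent infinite word, $S$ a Rauzy scheme for $W$, and $l$ an admissible path with word $u=F(l)$. If $uu_1$ is a factor of $W$ for some word $u_1$, then $S$ contains an admissible path $l'$ whose edge record begins with the edge record of $l$ and whose word $F(l')$ begins with $uu_1$.
   Context: $u\sqsubseteq w$: $u$ is a factor of $w$; $u\sqsubseteq_k w$: at least $k$ occurrences. $W$ recurrent: every factor occurs infinitely often. A graph with words is a strongly connected directed multigraph each edge $e$ of which carries a front word $F(e)$ and a back word $B(e)$, every vertex being distributing (in-degree $1$, out-degree $>1$) or collecting (in-degree $>1$, out-degree $1$). Paths are sequences of consecutive edges, identified with their edge records (words over the edge set); $s_1\sqsubseteq_k s_2$ refers to occurrences of edge records. Symmetric path: first edge starts at a collecting vertex, last edge ends at a distributing vertex. For $s=v_1\dots v_n$: $F(s)$ = ordered concatenation of front words of $v_1$ and all $v_i$ starting at a distributing vertex; $B(s)$ = ordered concatenation of back words of all $v_i$ ending at a collecting vertex and of $v_n$. $S$ is a Rauzy scheme for $W$ if: (1) strongly connected, more than one edge; (2) front words of edges leaving one distributing vertex have pairwise different first letters, back words of edges entering one collecting vertex have pairwise different last letters; (3) $F(s)=B(s)$ for symmetric $s$; (4) for symmetric $s_1,s_2$, $F(s_1)\sqsubseteq_kF(s_2)\Rightarrow s_1\sqsubseteq_k s_2$; (5) edge words are factors of $W$; (6) each factor of $W$ is a factor of some $F(s)$, $s$ symmetric; (7) for each edge $e$ there is a factor $u_e$ of $W$ such that each symmetric $s$ with $u_e\sqsubseteq F(s)$ passes through $e$.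 A symmetric path $s$ is admissible if $F(s)\sqsubseteq W$. -}

module Defs where

open import Data.Nat using (ℕ; zero; suc; _+_; _≤_; _<_; _≡ᵇ_; _<ᵇ_)
open import Data.Fin using (Fin)
open import Data.Fin.Properties using (_≟_)
open import Data.List using (List; []; _∷_; _++_; length; map; upTo; filter; allFin; head; last; drop)
open import Data.List.Membership.Propositional using (_∈_)
import Relation.Nullary.Decidable.Core
import Data.Sum
import Data.Bool
open import Data.Bool using (Bool; true; false; if_then_else_; _∧_)
open import Data.Maybe using (Maybe; just)
open import Data.Product using (Σ; ∃; _×_; _,_)
open import Data.Unit using (⊤)
open import Data.Empty using (⊥)
open import Relation.Binary.PropositionalEquality using (_≡_; _≢_)
open import Relation.Binary.Construct.Closure.ReflexiveTransitive using (Star)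
open import Function.Definitions using (Injective)

InfWord : Set → Set
InfWord A = ℕ → A

window : {A : Set} → InfWord A → ℕ → ℕ → List A
window W i n = map (λ j → W (i + j)) (upTo n)

FactorInf : {A : Set} → List A → InfWord A → Set
FactorInf u W = ∃ λ i → window W i (length u) ≡ u

Recurrent : {A : Set} → InfWord A → Set
Recurrent W = ∀ u → FactorInf u W → ∀ n → ∃ λ i → n ≤ i × window W i (length u) ≡ u

_⊑_ : {A : Set} → List A → List A → Set
u ⊑ w = ∃ λ p → ∃ λ s → w ≡ p ++ (u ++ s)

OccAt : {A : Set} → List A → List A → ℕ → Set
OccAt u w i = ∃ λ s → drop i w ≡ u ++ s

-- u ⊑_k w : u has at least k occurrences in w (k pairwise distinct positions).
_⊑[_]_ : {A : Set} → List A → ℕ → List A → Set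
u ⊑[ k ] w = Σ (Fin k → ℕ) λ f → Injective _≡_ _≡_ f × (∀ j → OccAt u w (f j))

HeadsDiffer : {A : Set} → List A → List A → Set
HeadsDiffer {A} u v = Σ A λ a → Σ A λ b → Σ (List A) λ u' → Σ (List A) λ v' →
  u ≡ a ∷ u' × v ≡ b ∷ v' × a ≢ b

LastsDiffer : {A : Set} → List A → List A → Set
LastsDiffer {A} u v = Σ A λ a → Σ A λ b → Σ (List A) λ u' → Σ (List A) λ v' →
  u ≡ u' ++ (a ∷ []) × v ≡ v' ++ (b ∷ []) × a ≢ b

record GraphWW (A : Set) : Set where
  field
    nV nE : ℕ
    src tgt : Fin nE → Fin nV
    Fw Bw : Fin nE → List A

  Vertex = Fin nV
  Edge = Fin nE

  count : (Edge → Bool) → ℕ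
  count p = length (filter (λ e → Data.Bool._≟_ (p e) true) (allFin nE))

  indeg outdeg : Vertex → ℕ
  indeg v = count (λ e → Relation.Nullary.Decidable.Core.isYes (tgt e ≟ v))
  outdeg v = count (λ e → Relation.Nullary.Decidable.Core.isYes (src e ≟ v))

  distributing : Vertex → Bool
  distributing v = (indeg v ≡ᵇ 1) ∧ (1 <ᵇ outdeg v)

  collecting : Vertex → Bool
  collecting v = (1 <ᵇ indeg v) ∧ (outdeg v ≡ᵇ 1)

  Adj : Vertex → Vertex → Set
  Adj v w = ∃ λ e → src e ≡ v × tgt e ≡ w

  StronglyConnected : Set
  StronglyConnected = ∀ v w → Star Adj v w

  -- paths = nonempty lists of consecutive edges (edge records)
  Chain : Edge → List Edge → Set
  Chain e [] = ⊤
  Chain e (e' ∷ es) = tgt e ≡ src e' × Chain e' es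

  IsPath : List Edge → Set
  IsPath [] = ⊥
  IsPath (e ∷ es) = Chain e es

  Fdist : List Edge → List A
  Fdist [] = []
  Fdist (e ∷ es) = (if distributing (src e) then Fw e else []) ++ Fdist es

  F : List Edge → List A
  F [] = []
  F (e ∷ es) = Fw e ++ Fdist es

  B : List Edge → List A
  B [] = []
  B (e ∷ []) = Bw e
  B (e ∷ e' ∷ es) = (if collecting (tgt e) then Bw e else []) ++ B (e' ∷ es)

  Symmetric : List Edge → Set
  Symmetric s = IsPath s × (Σ Edge λ e₁ → Σ Edge λ eₙ →
    head s ≡ just e₁ × last s ≡ just eₙ ×
    collecting (src e₁) ≡ true × distributing (tgt eₙ) ≡ true)


record IsRauzyScheme {A : Set} (W : InfWord A) (S : GraphWW A) : Set where
  open GraphWW S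
  field
    dist-or-coll : ∀ v → distributing v ≡ true Data.Sum.⊎ collecting v ≡ true
    strongly-connected : StronglyConnected
    more-than-one-edge : 1 < GraphWW.nE S
    front-first-letters : ∀ v → distributing v ≡ true → ∀ e e' → src e ≡ v → src e' ≡ v →
                          e ≢ e' → HeadsDiffer (Fw e) (Fw e')
    back-last-letters : ∀ v → collecting v ≡ true → ∀ e e' → tgt e ≡ v → tgt e' ≡ v →
                        e ≢ e' → LastsDiffer (Bw e) (Bw e')
    F≡B : ∀ s → Symmetric s → F s ≡ B s
    -- (4)
    occurrences : ∀ s₁ s₂ → Symmetric s₁ → Symmetric s₂ → ∀ k →
                  F s₁ ⊑[ k ] F s₂ → s₁ ⊑[ k ] s₂
    front-factor : ∀ e → FactorInf (Fw e) W
    back-factor : ∀ e → FactorInf (Bw e) W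
    -- (6)
    covers : ∀ u → FactorInf u W → Σ (List Edge) λ s → Symmetric s × u ⊑ F s
    edge-witness : ∀ e → Σ (List A) λ uₑ → FactorInf uₑ W ×
                   (∀ s → Symmetric s → uₑ ⊑ F s → e ∈ s)

Admissible : {A : Set} → InfWord A → (S : GraphWW A) → List (GraphWW.Edge S) → Set
Admissible W S s = GraphWW.Symmetric S s × FactorInf (GraphWW.F S s) W

-- Extend u u₁ inside W by ΣFw further letters, where ΣFw bounds the length of every front
-- word; by axiom (6) the extended factor lies in F s for some symmetric path s. Its leading
-- occurrence of u = F l comes from an occurrence of the edge record l in s: occurrences of l
-- in s inject into occurrences of F l in F s, and by axiom (4) the latter are no more
-- numerous, so the injection is onto. Following s beyond l up to the first distributing
-- vertex at which the front words have spelled u₁ overshoots by at most one front word,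
-- hence F l' is a prefix of the extended factor and so a factor of W.

module Submission where

open import Defs
open import Data.Nat using (ℕ; zero; suc; _+_; _≤_; _<_; _≤?_; z≤n; s≤s)
open import Data.Nat.Properties
  using (module ≤-Reasoning; ≤-trans; ≤-<-trans; <⇒≱; <-cmp; <⇒≢; ≰⇒>; ≤-total; <-irrefl; m≤m+n; m≤n+m; m<n+m; <ᵇ⇒<)
open import Data.Nat.ListAction using (sum)
open import Data.Fin using (Fin; zero; suc)
open import Data.Fin.Properties using (pigeonhole) renaming (_≟_ to _≟ᶠ_; any? to anyᶠ?; <⇒≢ to <⇒≢ᶠ)
open import Data.List using (List; []; _∷_; _++_; length; map; upTo; applyUpTo; filter; allFin; take; drop; lookup; last)
open import Data.List.Properties
  using (∷-injective; ∷-injectiveˡ; ∷-injectiveʳ; ++-assoc; ++-identityʳ; ++-cancelˡ; length-++; length-map; length-applyUpTo; map-applyUpTo; take++drop≡id)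
open import Data.List.Membership.Propositional using (_∈_; find)
open import Data.List.Membership.Propositional.Properties using (∈-lookup; ∈-filter⁺; ∈-filter⁻; ∈-upTo⁺; ∈-map⁺; ∈-allFin)
open import Data.List.Relation.Unary.All as All using (All; []; _∷_)
open import Data.List.Relation.Unary.All.Properties using (all-filter; ¬Any⇒All¬) renaming (map⁺ to All-map⁺)
open import Data.List.Relation.Unary.Any using (here; there; index; any?)
open import Data.List.Relation.Unary.Any.Properties using (lookup-index)
open import Data.List.Relation.Unary.AllPairs using ([]; _∷_)
open import Data.List.Relation.Unary.Unique.Propositional using (Unique)
open import Data.List.Relation.Unary.Unique.Propositional.Properties using (allFin⁺; upTo⁺) renaming (filter⁺ to Unique-filter⁺)
open import Data.Bool using (true; false; if_then_else_)
open import Data.Bool.Properties using (T-≡; T-∧)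
import Data.Bool
open import Data.Maybe using (just)
open import Data.Maybe.Properties using (just-injective)
open import Data.Product using (Σ; ∃; ∃₂; _×_; _,_; proj₁; proj₂)
open import Data.Sum using (inj₁; inj₂)
open import Data.Empty using (⊥-elim)
open import Function using (_∘_; id)
open import Function.Bundles using (Equivalence)
open import Function.Definitions using (Injective)
open import Relation.Binary using (tri<; tri≈; tri>)
open import Relation.Binary.Definitions using (DecidableEquality)
open import Relation.Binary.PropositionalEquality using (_≡_; _≢_; refl; sym; trans; cong; subst; module ≡-Reasoning)
open import Relation.Nullary using (Dec; yes; no)
open import Relation.Nullary.Decidable using (_×-dec_; ¬?; isYes; toWitness; decidable-stable)
open import Relation.Unary using (Decidable)

module _ {X : Set} where

  ++-split : ∀ (a b c d : List X) → a ++ b ≡ c ++ d → length a ≤ length c →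
             ∃ λ r → c ≡ a ++ r × b ≡ r ++ d
  ++-split []      b c       d eq _ = c , refl , eq
  ++-split (x ∷ a) b (y ∷ c) d eq (s≤s a≤c) with refl , eq′ ← ∷-injective eq
    with r , c≡ , b≡ ← ++-split a b c d eq′ a≤c = r , cong (x ∷_) c≡ , b≡

  take-++-length : ∀ {xs ys : List X} {n} → length xs ≡ n → take n (xs ++ ys) ≡ xs
  take-++-length {[]}     refl = refl
  take-++-length {x ∷ xs} refl = cong (x ∷_) (take-++-length refl)

  drop-length-++ : ∀ (xs ys : List X) → drop (length xs) (xs ++ ys) ≡ ys
  drop-length-++ []       ys = refl
  drop-length-++ (_ ∷ xs) ys = drop-length-++ xs ys

  drop≡∷⇒< : ∀ j (xs : List X) {y ys} → drop j xs ≡ y ∷ ys → j < length xs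
  drop≡∷⇒< zero    (_ ∷ _)  _  = s≤s z≤n
  drop≡∷⇒< (suc j) (_ ∷ xs) eq = s≤s (drop≡∷⇒< j xs eq)

  0<length-++-∷ : ∀ (xs : List X) {y ys} → 0 < length (xs ++ y ∷ ys)
  0<length-++-∷ []      = s≤s z≤n
  0<length-++-∷ (_ ∷ _) = s≤s z≤n

  length-++-monoʳ-≤ : ∀ (xs : List X) {ys zs} → length ys ≤ length zs → length (xs ++ ys) ≤ length (xs ++ zs)
  length-++-monoʳ-≤ []       le = le
  length-++-monoʳ-≤ (_ ∷ xs) le = s≤s (length-++-monoʳ-≤ xs le)

  length-++-monoʳ-< : ∀ (xs : List X) {ys zs} → length ys < length zs → length (xs ++ ys) < length (xs ++ zs)
  length-++-monoʳ-< []       lt = lt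
  length-++-monoʳ-< (_ ∷ xs) lt = s≤s (length-++-monoʳ-< xs lt)

  prefix? : DecidableEquality X → ∀ (u w : List X) → Dec (∃ λ s → w ≡ u ++ s)
  prefix? _≟_ []      w       = yes (w , refl)
  prefix? _≟_ (x ∷ u) []      = no λ ()
  prefix? _≟_ (x ∷ u) (y ∷ w) with x ≟ y | prefix? _≟_ u w
  ... | yes refl | yes (s , w≡) = yes (s , cong (x ∷_) w≡)
  ... | yes refl | no  ¬pre     = no λ (s , eq) → ¬pre (s , ∷-injectiveʳ eq)
  ... | no  x≢y  | _            = no λ (s , eq) → x≢y (sym (∷-injectiveˡ eq))

  lookup-injective : ∀ {xs : List X} → Unique xs → Injective _≡_ _≡_ (lookup xs)
  lookup-injective (_   ∷ _) {zero}  {zero}  _  = refl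
  lookup-injective (x∉ ∷ _) {zero}  {suc j} eq = ⊥-elim (All.lookup x∉ (∈-lookup j) eq)
  lookup-injective (x∉ ∷ _) {suc i} {zero}  eq = ⊥-elim (All.lookup x∉ (∈-lookup i) (sym eq))
  lookup-injective (_   ∷ u) {suc i} {suc j} eq = cong suc (lookup-injective u eq)

  Unique-map⁺-on : ∀ {Y : Set} {P : X → Set} {f : X → Y} {xs} →
                   (∀ {x y} → P x → P y → f x ≡ f y → x ≡ y) → All P xs → Unique xs → Unique (map f xs)
  Unique-map⁺-on f-inj []         []         = []
  Unique-map⁺-on f-inj (px ∷ pxs) (x∉ ∷ xs!) =
    All-map⁺ (All.zipWith (λ (py , x≢y) fx≡fy → x≢y (f-inj px py fx≡fy)) (pxs , x∉)) ∷ Unique-map⁺-on f-inj pxs xs!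

  Unique-All≡⇒length≤1 : ∀ {x} {xs : List X} → All (_≡ x) xs → Unique xs → length xs ≤ 1
  Unique-All≡⇒length≤1 []                    []                = z≤n
  Unique-All≡⇒length≤1 (_ ∷ [])              _                 = s≤s z≤n
  Unique-All≡⇒length≤1 (y≡x ∷ y′≡x ∷ _)     ((y≢y′ ∷ _) ∷ _) = ⊥-elim (y≢y′ (trans y≡x (sym y′≡x)))

∈⇒≤sum : ∀ {n ns} → n ∈ ns → n ≤ sum ns
∈⇒≤sum (here refl)          = m≤m+n _ _
∈⇒≤sum {ns = m ∷ _} (there p) = ≤-trans (∈⇒≤sum p) (m≤n+m _ m)

AtLeast : ℕ → (ℕ → Set) → Set
AtLeast k P = Σ (Fin k → ℕ) λ f → Injective _≡_ _≡_ f × (∀ r → P (f r))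

AtLeast-≤-length : ∀ {P : ℕ → Set} {k xs} → (∀ {j} → P j → j ∈ xs) → AtLeast k P → k ≤ length xs
AtLeast-≤-length {k = k} {xs} P⊆xs (f , f-inj , Pf) with k ≤? length xs
... | yes k≤ = k≤
... | no  k≰ with i , j , i<j , same ← pigeonhole (≰⇒> k≰) (λ r → index (P⊆xs (Pf r))) =
  ⊥-elim (<⇒≢ᶠ i<j (f-inj (trans (lookup-index (P⊆xs (Pf i)))
                             (trans (cong (lookup xs) same) (sym (lookup-index (P⊆xs (Pf j))))))))

Unique⇒AtLeast : ∀ {P : ℕ → Set} {xs} → Unique xs → All P xs → AtLeast (length xs) P
Unique⇒AtLeast {xs = xs} xs! Pxs = lookup xs , lookup-injective xs! , λ r → All.lookup Pxs (∈-lookup r)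

module _ {Occ U : ℕ → Set} (Occ? : Decidable Occ) {N : ℕ} (Occ⇒<N : ∀ {j} → Occ j → j < N)
         {φ : ℕ → ℕ} (φ-injective : ∀ {j j′} → Occ j → Occ j′ → φ j ≡ φ j′ → j ≡ j′)
         (φ-sound : ∀ {j} → Occ j → U (φ j))
         (AtLeast-reflect : ∀ {k} → AtLeast k U → AtLeast k Occ) where

  private
    witnesses : List ℕ
    witnesses = filter Occ? (upTo N)

    Occ⇒∈ : ∀ {j} → Occ j → j ∈ witnesses
    Occ⇒∈ o = ∈-filter⁺ Occ? (∈-upTo⁺ (Occ⇒<N o)) o

    Occ-witnesses : All Occ witnesses
    Occ-witnesses = all-filter Occ? (upTo N)

  image-complete : ∀ {i} → U i → ∃ λ j → Occ j × φ j ≡ i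
  image-complete {i} Ui with any? (λ j → φ j Data.Nat.≟ i) witnesses
  ... | yes hit with j , j∈ , φj≡i ← find hit = j , proj₂ (∈-filter⁻ Occ? {xs = upTo N} j∈) , φj≡i
  ... | no  miss = ⊥-elim (<-irrefl refl (subst (_≤ length witnesses) (cong suc (length-map φ witnesses)) bound))
    where
    images! : Unique (i ∷ map φ witnesses)
    images! = All-map⁺ (All.map (λ φj≢i i≡φj → φj≢i (sym i≡φj)) (¬Any⇒All¬ witnesses miss))
            ∷ Unique-map⁺-on φ-injective Occ-witnesses (Unique-filter⁺ Occ? {upTo N} (upTo⁺ N))
    bound : length (i ∷ map φ witnesses) ≤ length witnesses
    bound = AtLeast-≤-length Occ⇒∈ (AtLeast-reflect (Unique⇒AtLeast images! (Ui ∷ All-map⁺ (All.map φ-sound Occ-witnesses))))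

module _ {A : Set} (W : InfWord A) where

  window≡applyUpTo : ∀ i n → window W i n ≡ applyUpTo (λ j → W (i + j)) n
  window≡applyUpTo i n = map-applyUpTo id (λ j → W (i + j)) n

  length-window : ∀ i n → length (window W i n) ≡ n
  length-window i n = trans (cong length (window≡applyUpTo i n)) (length-applyUpTo _ n)

  window-++ : ∀ i m n → ∃ λ v → length v ≡ n × window W i (m + n) ≡ window W i m ++ v
  window-++ i m n = applyUpTo (λ j → W (i + (m + j))) n , length-applyUpTo _ n ,
    trans (window≡applyUpTo i (m + n))
      (trans (applyUpTo-++ (λ j → W (i + j)) m) (cong (_++ applyUpTo (λ j → W (i + (m + j))) n) (sym (window≡applyUpTo i m))))
    where
    applyUpTo-++ : ∀ (f : ℕ → A) m → applyUpTo f (m + n) ≡ applyUpTo f m ++ applyUpTo (λ j → f (m + j)) n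
    applyUpTo-++ f zero    = refl
    applyUpTo-++ f (suc m) = cong (f 0 ∷_) (applyUpTo-++ (f ∘ suc) m)

  FactorInf-++⁻ˡ : ∀ {x y} → FactorInf (x ++ y) W → FactorInf x W
  FactorInf-++⁻ˡ {x} {y} (i , eq) with v , _ , split ← window-++ i (length x) (length y) = i , (begin
    window W i (length x)                          ≡⟨ take-++-length (length-window i (length x)) ⟨
    take (length x) (window W i (length x) ++ v)   ≡⟨ cong (take (length x)) split ⟨
    take (length x) (window W i (length x + length y)) ≡⟨ cong (take (length x) ∘ window W i) (length-++ x) ⟨
    take (length x) (window W i (length (x ++ y))) ≡⟨ cong (take (length x)) eq ⟩
    take (length x) (x ++ y)                       ≡⟨ take-++-length refl ⟩
    x                                              ∎)
    where open ≡-Reasoning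

  FactorInf-extendʳ : ∀ {x} → FactorInf x W → ∀ n → ∃ λ v → length v ≡ n × FactorInf (x ++ v) W
  FactorInf-extendʳ {x} (i , eq) n with v , ∣v∣≡n , split ← window-++ i (length x) n = v , ∣v∣≡n , i , (begin
    window W i (length (x ++ v))     ≡⟨ cong (window W i) (trans (length-++ x) (cong (length x +_) ∣v∣≡n)) ⟩
    window W i (length x + n)        ≡⟨ split ⟩
    window W i (length x) ++ v       ≡⟨ cong (_++ v) eq ⟩
    x ++ v                           ∎)
    where open ≡-Reasoning

module Paths {A : Set} (S : GraphWW A) where
  open GraphWW S

  lastFrom : Edge → List Edge → Edge
  lastFrom x []       = x
  lastFrom _ (y ∷ ys) = lastFrom y ys

  EndsDistributing : Edge → List Edge → Set
  EndsDistributing x xs = distributing (tgt (lastFrom x xs)) ≡ true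

  last-∷ : ∀ x xs → last (x ∷ xs) ≡ just (lastFrom x xs)
  last-∷ x []       = refl
  last-∷ x (y ∷ ys) = last-∷ y ys

  lastFrom-++ : ∀ x xs ys → lastFrom x (xs ++ ys) ≡ lastFrom (lastFrom x xs) ys
  lastFrom-++ x []       ys = refl
  lastFrom-++ x (y ∷ xs) ys = lastFrom-++ y xs ys

  Chain-++⁻ˡ : ∀ x xs ys → Chain x (xs ++ ys) → Chain x xs
  Chain-++⁻ˡ x []       ys _         = _
  Chain-++⁻ˡ x (y ∷ xs) ys (x↝y , c) = x↝y , Chain-++⁻ˡ y xs ys c

  Chain-++⁻ʳ : ∀ x xs ys → Chain x (xs ++ ys) → Chain (lastFrom x xs) ys
  Chain-++⁻ʳ x []       ys c       = c
  Chain-++⁻ʳ x (y ∷ xs) ys (_ , c) = Chain-++⁻ʳ y xs ys c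

  Symmetric-∷⁺ : ∀ {x xs} → Chain x xs → collecting (src x) ≡ true → EndsDistributing x xs → Symmetric (x ∷ xs)
  Symmetric-∷⁺ {x} {xs} c coll end = c , x , lastFrom x xs , refl , last-∷ x xs , coll , end

  Symmetric-∷⁻ : ∀ {x xs} → Symmetric (x ∷ xs) → collecting (src x) ≡ true × EndsDistributing x xs
  Symmetric-∷⁻ {x} {xs} (_ , _ , _ , refl , last≡ , coll , end) =
    coll , subst (λ e → distributing (tgt e) ≡ true) (just-injective (trans (sym last≡) (last-∷ x xs))) end

  Symmetric-++⁻ʳ : ∀ p {y ys} → Symmetric (p ++ y ∷ ys) → Chain y ys × EndsDistributing y ys
  Symmetric-++⁻ʳ []        symS = proj₁ symS , proj₂ (Symmetric-∷⁻ symS)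
  Symmetric-++⁻ʳ (p₀ ∷ ps) {y} {ys} symS =
    proj₂ (Chain-++⁻ʳ p₀ ps (y ∷ ys) (proj₁ symS)) ,
    subst (λ e → distributing (tgt e) ≡ true) (lastFrom-++ p₀ ps (y ∷ ys)) (proj₂ (Symmetric-∷⁻ symS))

  Symmetric-++⁻ˡ : ∀ p {y ys t} → Symmetric (p ++ y ∷ ys ++ t) → Symmetric (y ∷ ys) → Symmetric (p ++ y ∷ ys)
  Symmetric-++⁻ˡ []        _    symL = symL
  Symmetric-++⁻ˡ (p₀ ∷ ps) {y} {ys} {t} symS symL = Symmetric-∷⁺ chain (proj₁ (Symmetric-∷⁻ symS)) end
    where
    chain : Chain p₀ (ps ++ y ∷ ys)
    chain = Chain-++⁻ˡ p₀ (ps ++ y ∷ ys) t (subst (Chain p₀) (sym (++-assoc ps (y ∷ ys) t)) (proj₁ symS))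
    end : EndsDistributing p₀ (ps ++ y ∷ ys)
    end = subst (λ e → distributing (tgt e) ≡ true) (sym (lastFrom-++ p₀ ps (y ∷ ys))) (proj₂ (Symmetric-∷⁻ symL))

  Fdist-++ : ∀ xs ys → Fdist (xs ++ ys) ≡ Fdist xs ++ Fdist ys
  Fdist-++ []       ys = refl
  Fdist-++ (x ∷ xs) ys = trans (cong (_ ++_) (Fdist-++ xs ys)) (sym (++-assoc _ (Fdist xs) (Fdist ys)))

  F-++ : ∀ x xs ys → F (x ∷ xs ++ ys) ≡ F (x ∷ xs) ++ Fdist ys
  F-++ x xs ys = trans (cong (Fw x ++_) (Fdist-++ xs ys)) (sym (++-assoc (Fw x) (Fdist xs) (Fdist ys)))

  Fdist-∷-distributing : ∀ {e} es → distributing (src e) ≡ true → Fdist (e ∷ es) ≡ Fw e ++ Fdist es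
  Fdist-∷-distributing _ dist rewrite dist = refl

  Fdist-∷-other : ∀ {e} es → distributing (src e) ≡ false → Fdist (e ∷ es) ≡ Fdist es
  Fdist-∷-other _ ¬dist rewrite ¬dist = refl

  collectingBack : Edge → List A
  collectingBack e = if collecting (tgt e) then Bw e else []

  Bcoll : List Edge → List A
  Bcoll []       = []
  Bcoll (e ∷ es) = collectingBack e ++ Bcoll es

  B-++ : ∀ p y ys → B (p ++ y ∷ ys) ≡ Bcoll p ++ B (y ∷ ys)
  B-++ []            y ys = refl
  B-++ (e ∷ [])      y ys = cong (_++ B (y ∷ ys)) (sym (++-identityʳ (collectingBack e)))
  B-++ (e ∷ e′ ∷ ps) y ys = trans (cong (collectingBack e ++_) (B-++ (e′ ∷ ps) y ys))
                                  (sym (++-assoc (collectingBack e) (Bcoll (e′ ∷ ps)) (B (y ∷ ys))))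

  length-Bcoll-take-mono : ∀ {j j′} → j ≤ j′ → ∀ s → length (Bcoll (take j s)) ≤ length (Bcoll (take j′ s))
  length-Bcoll-take-mono z≤n      _       = z≤n
  length-Bcoll-take-mono (s≤s _)  []      = z≤n
  length-Bcoll-take-mono (s≤s j≤j′) (e ∷ s) = length-++-monoʳ-≤ (collectingBack e) (length-Bcoll-take-mono j≤j′ s)

  ΣFw : ℕ
  ΣFw = sum (map (length ∘ Fw) (allFin nE))

  Fw≤ΣFw : ∀ e → length (Fw e) ≤ ΣFw
  Fw≤ΣFw e = ∈⇒≤sum (∈-map⁺ (length ∘ Fw) (∈-allFin e))

  suffix-of-Fw≤ΣFw : ∀ e {u r} → Fw e ≡ u ++ r → length r ≤ ΣFw
  suffix-of-Fw≤ΣFw e {u} {r} Fw≡ = begin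
    length r            ≤⟨ m≤n+m (length r) (length u) ⟩
    length u + length r ≡⟨ length-++ u ⟨
    length (u ++ r)     ≡⟨ cong length Fw≡ ⟨
    length (Fw e)       ≤⟨ Fw≤ΣFw e ⟩
    ΣFw                 ∎
    where open ≤-Reasoning

  distributing-step : ∀ {x e b} → tgt x ≡ src e → distributing (tgt x) ≡ b → distributing (src e) ≡ b
  distributing-step x↝e d = trans (cong distributing (sym x↝e)) d

  silent-prefix : ∀ x q → Chain x q → EndsDistributing x q →
                       ∃₂ λ q′ q″ → q ≡ q′ ++ q″ × Fdist q′ ≡ [] × EndsDistributing x q′
  silent-prefix x q c end with distributing (tgt x) in dist
  ... | true = [] , q , refl , refl , dist
  silent-prefix x []       _        end | false with () ← trans (sym dist) end
  silent-prefix x (e ∷ q₁) (x↝e , c) end | false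
    with q₁′ , q″ , q₁≡ , Fq₁′≡[] , end′ ← silent-prefix e q₁ c end =
    e ∷ q₁′ , q″ , cong (e ∷_) q₁≡ , trans (Fdist-∷-other q₁′ (distributing-step x↝e dist)) Fq₁′≡[] , end′

  covering-prefix : ∀ x q → Chain x q → EndsDistributing x q → ∀ u v → Fdist q ≡ u ++ v →
           ∃₂ λ q′ q″ → q ≡ q′ ++ q″ × EndsDistributing x q′ ×
             ∃ λ r → Fdist q′ ≡ u ++ r × length r ≤ ΣFw
  covering-prefix x q c end u v eq with distributing (tgt x) in dist
  covering-prefix x [] _ end u v eq | false with () ← trans (sym dist) end
  covering-prefix x (e ∷ q₁) (x↝e , c) end u v eq | false
    with q₁′ , q″ , q₁≡ , end′ , r , Fq₁′≡ , r≤
           ← covering-prefix e q₁ c end u v (trans (sym (Fdist-∷-other q₁ (distributing-step x↝e dist))) eq) =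
    e ∷ q₁′ , q″ , cong (e ∷_) q₁≡ , end′ , r , trans (Fdist-∷-other q₁′ (distributing-step x↝e dist)) Fq₁′≡ , r≤
  covering-prefix x [] _ _ [] v _ | true = [] , [] , refl , dist , [] , refl , z≤n
  covering-prefix x (e ∷ q₁) (x↝e , c) end u v eq | true
    with eq′ ← trans (sym (Fdist-∷-distributing q₁ (distributing-step x↝e dist))) eq
       | ≤-total (length (Fw e)) (length u)
  ... | inj₁ Fw≤u
    with r′ , u≡ , Fq₁≡ ← ++-split (Fw e) (Fdist q₁) u v eq′ Fw≤u
    with q₁′ , q″ , q₁≡ , end′ , r , Fq₁′≡ , r≤ ← covering-prefix e q₁ c end r′ v Fq₁≡ =
    e ∷ q₁′ , q″ , cong (e ∷_) q₁≡ , end′ , r , Fdist-e∷q₁′ , r≤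
    where
    open ≡-Reasoning
    Fdist-e∷q₁′ : Fdist (e ∷ q₁′) ≡ u ++ r
    Fdist-e∷q₁′ = begin
      Fdist (e ∷ q₁′)   ≡⟨ Fdist-∷-distributing q₁′ (distributing-step x↝e dist) ⟩
      Fw e ++ Fdist q₁′ ≡⟨ cong (Fw e ++_) Fq₁′≡ ⟩
      Fw e ++ r′ ++ r   ≡⟨ ++-assoc (Fw e) r′ r ⟨
      (Fw e ++ r′) ++ r ≡⟨ cong (_++ r) u≡ ⟨
      u ++ r            ∎
  ... | inj₂ u≤Fw
    with r , Fw≡ , _ ← ++-split u v (Fw e) (Fdist q₁) (sym eq′) u≤Fw
    with q₁′ , q″ , q₁≡ , Fq₁′≡[] , end′ ← silent-prefix e q₁ c end =
    e ∷ q₁′ , q″ , cong (e ∷_) q₁≡ , end′ , r , Fdist-e∷q₁′ , suffix-of-Fw≤ΣFw e {u} Fw≡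
    where
    open ≡-Reasoning
    Fdist-e∷q₁′ : Fdist (e ∷ q₁′) ≡ u ++ r
    Fdist-e∷q₁′ = begin
      Fdist (e ∷ q₁′)   ≡⟨ Fdist-∷-distributing q₁′ (distributing-step x↝e dist) ⟩
      Fw e ++ Fdist q₁′ ≡⟨ cong (Fw e ++_) Fq₁′≡[] ⟩
      Fw e ++ []        ≡⟨ ++-identityʳ (Fw e) ⟩
      Fw e              ≡⟨ Fw≡ ⟩
      u ++ r            ∎

module RauzySchemeProperties {A : Set} {W : InfWord A} {S : GraphWW A} (RS : IsRauzyScheme W S) where
  open GraphWW S
  open Paths S
  open IsRauzyScheme RS

  other-edge-into : ∀ {v} → collecting v ≡ true → ∀ e → ∃ λ e′ → tgt e′ ≡ v × e ≢ e′
  other-edge-into {v} coll e with anyᶠ? (λ e′ → (tgt e′ ≟ᶠ v) ×-dec ¬? (e ≟ᶠ e′))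
  ... | yes found = found
  ... | no  none  = ⊥-elim (<⇒≱ 1<indeg (Unique-All≡⇒length≤1 into≡e (Unique-filter⁺ _ (allFin⁺ nE))))
    where
    1<indeg : 1 < indeg v
    1<indeg = <ᵇ⇒< 1 (indeg v) (proj₁ (Equivalence.to T-∧ (Equivalence.from T-≡ coll)))
    into≡e : All (_≡ e) (filter (λ x → isYes (tgt x ≟ᶠ v) Data.Bool.≟ true) (allFin nE))
    into≡e = All.map (λ {x} into → sym (decidable-stable (e ≟ᶠ x)
                        (λ e≢x → none (x , toWitness (Equivalence.from T-≡ into) , e≢x))))
                     (all-filter _ (allFin nE))

  Bw-nonempty : ∀ {e} → collecting (tgt e) ≡ true → 0 < length (Bw e)
  Bw-nonempty {e} coll with e′ , e′↝ , e≢e′ ← other-edge-into coll e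
    with _ , _ , u′ , _ , Bw≡ , _ ← back-last-letters (tgt e) coll e e′ refl e′↝ e≢e′ =
    subst (λ w → 0 < length w) (sym Bw≡) (0<length-++-∷ u′)

  length-Bcoll-∷-< : ∀ {e} es → collecting (tgt e) ≡ true → length (Bcoll es) < length (Bcoll (e ∷ es))
  length-Bcoll-∷-< {e} es coll rewrite coll | length-++ (Bw e) {Bcoll es} = m<n+m (length (Bcoll es)) (Bw-nonempty coll)

  length-Bcoll-take-< : ∀ k {s y ys} → IsPath s → drop (suc k) s ≡ y ∷ ys → collecting (src y) ≡ true →
                        length (Bcoll (take k s)) < length (Bcoll (take (suc k) s))
  length-Bcoll-take-< zero    {x ∷ _ ∷ _}  (x↝y , _) refl coll = length-Bcoll-∷-< [] (trans (cong collecting x↝y) coll)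
  length-Bcoll-take-< (suc k) {x ∷ x′ ∷ s} (_ , c)   d    coll =
    length-++-monoʳ-< (collectingBack x) (length-Bcoll-take-< k {x′ ∷ s} c d coll)

  module _ {l₀ : Edge} {ls : List Edge} (symL : Symmetric (l₀ ∷ ls)) where
    private
      l : List Edge
      l = l₀ ∷ ls

    F-decomposition : ∀ p t → Symmetric (p ++ l ++ t) → F (p ++ l ++ t) ≡ Bcoll p ++ F l ++ Fdist t
    F-decomposition []        t _    = F-++ l₀ ls t
    F-decomposition (p₀ ∷ ps) t symS = begin
      F (p₀ ∷ ps ++ l ++ t)                ≡⟨ cong (F ∘ (p₀ ∷_)) (++-assoc ps l t) ⟨
      F (p₀ ∷ (ps ++ l) ++ t)              ≡⟨ F-++ p₀ (ps ++ l) t ⟩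
      F (p₀ ∷ ps ++ l) ++ Fdist t          ≡⟨ cong (_++ Fdist t) (F≡B _ (Symmetric-++⁻ˡ (p₀ ∷ ps) symS symL)) ⟩
      B (p₀ ∷ ps ++ l) ++ Fdist t          ≡⟨ cong (_++ Fdist t) (B-++ (p₀ ∷ ps) l₀ ls) ⟩
      (Bcoll (p₀ ∷ ps) ++ B l) ++ Fdist t  ≡⟨ cong (λ b → (Bcoll (p₀ ∷ ps) ++ b) ++ Fdist t) (F≡B l symL) ⟨
      (Bcoll (p₀ ∷ ps) ++ F l) ++ Fdist t  ≡⟨ ++-assoc (Bcoll (p₀ ∷ ps)) (F l) (Fdist t) ⟩
      Bcoll (p₀ ∷ ps) ++ F l ++ Fdist t    ∎
      where open ≡-Reasoning

    -- An occurrence of l at edge index j of s gives one of F l at letter index φ j of F s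
    -- (by F-decomposition); axiom (4) makes this correspondence onto.
    module _ {s : List Edge} (symS : Symmetric s) where
      private
        φ : ℕ → ℕ
        φ j = length (Bcoll (take j s))

        split-at : ∀ j {t} → drop j s ≡ l ++ t → s ≡ take j s ++ l ++ t
        split-at j d = trans (sym (take++drop≡id j s)) (cong (take j s ++_) d)

        drop-φ : ∀ j {t} → drop j s ≡ l ++ t → drop (φ j) (F s) ≡ F l ++ Fdist t
        drop-φ j {t} d = begin
          drop (φ j) (F s)                                   ≡⟨ cong (drop (φ j) ∘ F) (split-at j d) ⟩
          drop (φ j) (F (take j s ++ l ++ t))                ≡⟨ cong (drop (φ j)) (F-decomposition (take j s) t (subst Symmetric (split-at j d) symS)) ⟩
          drop (φ j) (Bcoll (take j s) ++ F l ++ Fdist t)    ≡⟨ drop-length-++ (Bcoll (take j s)) _ ⟩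
          F l ++ Fdist t                                     ∎
          where open ≡-Reasoning

        φ-strict : ∀ {j j′} → OccAt l s j′ → j < j′ → φ j < φ j′
        φ-strict {j′ = suc k} (_ , d) (s≤s j≤k) =
          ≤-<-trans (length-Bcoll-take-mono j≤k s) (length-Bcoll-take-< k (proj₁ symS) d (proj₁ (Symmetric-∷⁻ symL)))

        occurrence-at : ∀ P {v} → F s ≡ P ++ F l ++ v → OccAt (F l) (F s) (length P)
        occurrence-at P {v} Fs≡ = v , trans (cong (drop (length P)) Fs≡) (drop-length-++ P _)

        φ-injective : ∀ {j j′} → OccAt l s j → OccAt l s j′ → φ j ≡ φ j′ → j ≡ j′
        φ-injective {j} {j′} occ occ′ φ≡ with <-cmp j j′
        ... | tri< j<j′ _ _ = ⊥-elim (<⇒≢ (φ-strict occ′ j<j′) φ≡)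
        ... | tri≈ _ j≡j′ _ = j≡j′
        ... | tri> _ _ j>j′ = ⊥-elim (<⇒≢ (φ-strict occ j>j′) (sym φ≡))

      occurrence-lifts : ∀ {P v} → F s ≡ P ++ F l ++ v → ∃₂ λ p t → Symmetric (p ++ l ++ t) × Fdist t ≡ v
      occurrence-lifts {P} {v} Fs≡
        with j , (t , d) , φj≡∣P∣
               ← image-complete {U = OccAt (F l) (F s)} (λ j → prefix? _≟ᶠ_ l (drop j s))
                   (λ {j} (_ , d) → drop≡∷⇒< j s d) φ-injective (λ {j} (t , d) → Fdist t , drop-φ j d)
                   (λ {k} → occurrences l s symL symS k) {length P} (occurrence-at P Fs≡) =
        take j s , t , subst Symmetric (split-at j d) symS ,
        ++-cancelˡ (F l) (Fdist t) v (trans (sym (drop-φ j d)) (trans (cong (λ n → drop n (F s)) φj≡∣P∣) (proj₂ (occurrence-at P Fs≡))))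

    extension : ∀ p t {u v} → Symmetric (p ++ l ++ t) → Fdist t ≡ u ++ v →
                ∃₂ λ q r → Symmetric (l ++ q) × F (l ++ q) ≡ (F l ++ u) ++ r × length r ≤ ΣFw × ∃ λ v′ → v ≡ r ++ v′
    extension p t {u} {v} symS Fdist-t≡
      with chain , end ← Symmetric-++⁻ʳ p symS
      with q , q″ , t≡ , end-q , r , Fdist-q≡ , r≤
             ← covering-prefix (lastFrom l₀ ls) t (Chain-++⁻ʳ l₀ ls t chain)
                      (subst (λ e → distributing (tgt e) ≡ true) (lastFrom-++ l₀ ls t) end) u v Fdist-t≡ =
      q , r , Symmetric-∷⁺ chain-q (proj₁ (Symmetric-∷⁻ symL)) end-ls++q , F-l++q≡ , r≤ , Fdist q″ , v≡
      where
      open ≡-Reasoning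
      chain-q : Chain l₀ (ls ++ q)
      chain-q = Chain-++⁻ˡ l₀ (ls ++ q) q″
                  (subst (Chain l₀) (trans (cong (ls ++_) t≡) (sym (++-assoc ls q q″))) chain)
      end-ls++q : EndsDistributing l₀ (ls ++ q)
      end-ls++q = subst (λ e → distributing (tgt e) ≡ true) (sym (lastFrom-++ l₀ ls q)) end-q
      F-l++q≡ : F (l ++ q) ≡ (F l ++ u) ++ r
      F-l++q≡ = begin
        F (l ++ q)          ≡⟨ F-++ l₀ ls q ⟩
        F l ++ Fdist q      ≡⟨ cong (F l ++_) Fdist-q≡ ⟩
        F l ++ u ++ r       ≡⟨ ++-assoc (F l) u r ⟨
        (F l ++ u) ++ r     ∎
      v≡ : v ≡ r ++ Fdist q″
      v≡ = ++-cancelˡ u v (r ++ Fdist q″) (begin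
        u ++ v                    ≡⟨ Fdist-t≡ ⟨
        Fdist t                   ≡⟨ cong Fdist t≡ ⟩
        Fdist (q ++ q″)           ≡⟨ Fdist-++ q q″ ⟩
        Fdist q ++ Fdist q″       ≡⟨ cong (_++ Fdist q″) Fdist-q≡ ⟩
        (u ++ r) ++ Fdist q″      ≡⟨ ++-assoc u r (Fdist q″) ⟩
        u ++ r ++ Fdist q″        ∎)

lemma4 : {A : Set} (W : InfWord A) → Recurrent W →
         (S : GraphWW A) → IsRauzyScheme W S →
         (l : List (GraphWW.Edge S)) → Admissible W S l →
         (u₁ : List A) → FactorInf (GraphWW.F S l ++ u₁) W →
         Σ (List (GraphWW.Edge S)) λ l' → Admissible W S l' ×
           (Σ (List (GraphWW.Edge S)) λ t → l' ≡ l ++ t) ×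
           (Σ (List A) λ r → GraphWW.F S l' ≡ (GraphWW.F S l ++ u₁) ++ r)
lemma4 W _ S RS []        ((() , _) , _) _ _
lemma4 W _ S RS (l₀ ∷ ls) (symL , _) u₁ factor =
  let rest , ∣rest∣≡ΣFw , factor-w = FactorInf-extendʳ W factor ΣFw
      s , symS , P , Sfx , Fs≡ = covers _ factor-w
      p , t , symS′ , Fdist-t≡ = occurrence-lifts symL symS {P}
        (trans Fs≡ (cong (P ++_) (trans (++-assoc (F l ++ u₁) rest Sfx) (++-assoc (F l) u₁ (rest ++ Sfx)))))
      q , r , symL′ , F-l′≡ , r≤ΣFw , v′ , rest++Sfx≡ = extension symL p t symS′ Fdist-t≡
      r₁ , rest≡ , _ = ++-split r v′ rest Sfx (sym rest++Sfx≡) (subst (length r ≤_) (sym ∣rest∣≡ΣFw) r≤ΣFw)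
      w≡ : (F l ++ u₁) ++ rest ≡ F (l ++ q) ++ r₁
      w≡ = trans (cong ((F l ++ u₁) ++_) rest≡) (trans (sym (++-assoc _ r r₁)) (cong (_++ r₁) (sym F-l′≡)))
  in l ++ q , (symL′ , FactorInf-++⁻ˡ W (subst (λ w → FactorInf w W) w≡ factor-w)) , (q , refl) , (r , F-l′≡)
  where
  open GraphWW S
  open Paths S
  open IsRauzyScheme RS
  open RauzySchemeProperties RS
  l : List Edge
  l = l₀ ∷ ls
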